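{- Let $n,m\ge 0$ and let $e_0,\dots,e_{n+m-1}$ be finite ordinals, each $\ge 2$; put $N=e_0\cdots e_{n-1}$ and $M=e_n\cdots e_{n+m-1}$, and let $\iota\colon N\times M\to N\cdot M$, $\iota(i,j)=i\cdot M+j$, and similarly $\iota\colon N\times N\to N\cdot N$, $\iota(i,j)=i\cdot N+j$. Then: (i) for $f\colon n\to n+m$, $f(i)=i$, and the sequence $e_0\ldots e_{n+m-1}\,e_0\ldots e_{n-1}$ (source part $e_0\ldots e_{n+m-1}$, target part $e_0\ldots e_{n-1}$), the relation $F(J(f^{op}))$ is the graph of the first projection $\pi_1\circ\iota^{ -1}\colon N\cdot M\to N$ of $\mathbf{Set}_\omega$; (ii) for $g\colon m\to n+m$, $g(j)=n+j$, and the sequence $e_0\ldots e_{n+m-1}\,e_n\ldots e_{n+m-1}$, the relation $F(J(g^{op}))$ is the graph of the second projection $\pi_2\circ\iota^{ -1}\colon N\cdot M\to M$; (iii) for $w\colon n+n\to n$, $w(i)=i$ for $i<n$ and $w(i)=i-n$ for $n\le i<2n$, and the sequence $e_0\ldots e_{n-1}\,e_0\ldots e_{n-1}e_0\ldots e_{n-1}$, the relation $F(J(w^{op}))$ is the graph of the diagonal $\iota\circ\Delta\colon N\to N\cdot N$, $\Delta(i)=(i,i)$. Here $F$ denotes $F_{\overrightarrow{ab}}$ for the indicated sequence $\overrightarrow{ab}$, which in each case is appropriate for the relation in question (and these are all the appropriate sequences for these relations).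
   Context: $\mathbf{Set}_\omega$ is the full subcategory of $\mathbf{Set}$ on the finite ordinals. For a function $f\colon q\to r$ between finite ordinals, $J(f^{op})$ is the equivalence relation on the ordinal $r+q$ whose equivalence classes are the $r$ sets $\{i\}\cup\{j+r\mid j\in q,\ f(j)=i\}$, $i\in r$ (an arrow $r\to q$ of the category $\mathit{Gen}$, whose arrows $r\to q$ are equivalence relations on $r+q$). For a finite sequence $\overrightarrow{d}=d_0\ldots d_{k-1}$ of finite ordinals, $\iota_{\overrightarrow{d}}\colon d_0\times\dots\times d_{k-1}\to d_0\cdots d_{k-1}$ is the bijection $\iota_{\overrightarrow{d}}(i_0,\dots,i_{k-1})=\sum_{l} i_l\cdot d_{l+1}\cdots d_{k-1}$. For an equivalence relation $R$ on $r+q$ and a sequence $\overrightarrow{ab}=a_0\ldots a_{r-1}b_0\ldots b_{q-1}$ of finite ordinals $\ge2$, $F_{\overrightarrow{ab}}(R)$ is the set of $(i,j)\in(a_0\cdots a_{r-1})\times(b_0\cdots b_{q-1})$ such that the concatenation $\overrightarrow{c}$ of $\iota_{\overrightarrow{a}}^{ -1}(i)$ and $\iota_{\overrightarrow{b}}^{ -1}(j)$ satisfies $c_x=c_y$ whenever $(x,y)\in R$. With $e_x=a_x$ ($x<r$), $e_{r+j}=b_j$ ($j<q$), the sequence is appropriate for $R$ when $(x,y)\in R$ implies $e_x=e_y$. -}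

module Defs where

open import Data.Nat using (ℕ; zero; suc; _+_; _*_; _<_; _≤_)
open import Data.Fin using (Fin; toℕ; splitAt; _↑ˡ_; _↑ʳ_)
import Data.Fin as F
open import Data.Sum using (_⊎_; [_,_])
open import Data.Product using (Σ; ∃; _×_; _,_)
open import Function using (_∘_; id)
open import Relation.Binary.PropositionalEquality using (_≡_)

-- Finite ordinals are represented by ℕ (elements of the ordinal k are
-- naturals < k) or by Fin k where indexing is needed.

prodF : ∀ {k} → (Fin k → ℕ) → ℕ
prodF {zero} d = 1
prodF {suc k} d = d F.zero * prodF (λ l → d (F.suc l))

Tuple : ∀ {k} → (Fin k → ℕ) → Set
Tuple {k} d = (l : Fin k) → Fin (d l)

-- ι_d (i₀,…,i_{k-1}) = Σ_l i_l · d_{l+1} ⋯ d_{k-1}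
-- (the sum unfolded by peeling off the l = 0 summand)
ι : ∀ {k} (d : Fin k → ℕ) → Tuple d → ℕ
ι {zero} d t = 0
ι {suc k} d t = toℕ (t F.zero) * prodF (λ l → d (F.suc l))
              + ι (λ l → d (F.suc l)) (λ l → t (F.suc l))

-- binary relations on the ordinal r + q (arrows r → q of Gen when equivalences)
RelOn : ℕ → Set₁
RelOn k = Fin k → Fin k → Set

concatSeq : ∀ {r q} {A : Set} → (Fin r → A) → (Fin q → A) → Fin (r + q) → A
concatSeq {r} a b x = [ a , b ] (splitAt r x)

-- x lies in the class {i} ∪ {j + r | f j = i} of J(f^op)
InClass : ∀ {q r} → (Fin q → Fin r) → Fin r → Fin (r + q) → Set
InClass {q} {r} f i x = (x ≡ i ↑ˡ q) ⊎ Σ (Fin q) (λ j → (x ≡ r ↑ʳ j) × (f j ≡ i))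

J : ∀ {q r} → (Fin q → Fin r) → RelOn (r + q)
J {q} {r} f x y = Σ (Fin r) (λ i → InClass f i x × InClass f i y)

Fab : ∀ {r q} (a : Fin r → ℕ) (b : Fin q → ℕ) → RelOn (r + q) → ℕ → ℕ → Set
Fab a b R i j =
  (i < prodF a) × (j < prodF b) ×
  Σ (Tuple a) (λ u → Σ (Tuple b) (λ v →
    (ι a u ≡ i) × (ι b v ≡ j) ×
    (∀ x y → R x y → concatSeq (toℕ ∘ u) (toℕ ∘ v) x ≡ concatSeq (toℕ ∘ u) (toℕ ∘ v) y)))

Appropriate : ∀ {r q} (a : Fin r → ℕ) (b : Fin q → ℕ) → RelOn (r + q) → Set
Appropriate a b R = ∀ x y → R x y → concatSeq a b x ≡ concatSeq a b y

AllGe2 : ∀ {k} → (Fin k → ℕ) → Set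
AllGe2 d = ∀ x → 2 ≤ d x

incl₁ : ∀ n m → Fin n → Fin (n + m)
incl₁ n m i = i ↑ˡ m

incl₂ : ∀ n m → Fin m → Fin (n + m)
incl₂ n m j = n ↑ʳ j

codiag : ∀ n → Fin (n + n) → Fin n
codiag n x = [ id , id ] (splitAt n x)

firstPart : ∀ n m → (Fin (n + m) → ℕ) → Fin n → ℕ
firstPart n m e l = e (l ↑ˡ m)

secondPart : ∀ n m → (Fin (n + m) → ℕ) → Fin m → ℕ
secondPart n m e l = e (n ↑ʳ l)

GraphFst : ℕ → ℕ → ℕ → ℕ → Set
GraphFst N M x y = (x < N * M) ×
  Σ ℕ (λ i → Σ ℕ (λ j → (i < N) × (j < M) × (i * M + j ≡ x) × (y ≡ i)))

GraphSnd : ℕ → ℕ → ℕ → ℕ → Set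
GraphSnd N M x y = (x < N * M) ×
  Σ ℕ (λ i → Σ ℕ (λ j → (i < N) × (j < M) × (i * M + j ≡ x) × (y ≡ j)))

GraphDiag : ℕ → ℕ → ℕ → Set
GraphDiag N x y = (x < N) × (y ≡ x * N + x)

module Submission where

-- The code ι_d : d₀ × ⋯ × d_{k-1} → d₀⋯d_{k-1} is the
-- mixed-radix encoding, a bijection onto the numbers below d₀⋯d_{k-1}
-- (ι-bound, ι-surjective).  Cutting a sequence of radices d of length r + q
-- into its first r and last q entries, the code of a tuple is
-- (code of the first half)·(product of the second half) + (code of the second
-- half), and every pair of codes of halves is realised (ι-split,
-- split-realise).  On the other side, a labelling of r + q is constant on the
-- classes of J(f^op) exactly when its last q labels are its first r labels
-- reindexed along f (factors⇒respectsJ, respectsJ⇒factors); hence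
-- F_{ab}(J(f^op)) consists of the codes of the pairs (u, u ∘ f) of tuples
-- (Fab-J⇒, Fab-J⇐), and an appropriate sequence ab satisfies b = a ∘ f.  For f the two coproduct
-- injections this pairs the code of a tuple with the code of one of its halves,
-- i.e. gives the graphs of the projections; for the codiagonal it pairs the
-- code of u with the code of (u, u), i.e. the graph of the diagonal (ι-duplicate).

open import Defs
open import Data.Nat using (ℕ; _+_; _*_; zero; suc; _<_; _≤_; z≤n; s≤s)
open import Data.Nat.Properties
  using (*-comm; *-assoc; *-distribʳ-+; +-assoc; +-monoʳ-<; *-monoˡ-≤; ≤-trans; ≤-reflexive; +-comm; *-identityˡ)
open import Data.Fin using (Fin; toℕ; fromℕ<; splitAt; _↑ˡ_; _↑ʳ_; cast; combine; remQuot)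
import Data.Fin as F
open import Data.Fin.Properties
  using (splitAt-↑ˡ; splitAt-↑ʳ; toℕ-cast; toℕ-fromℕ<; toℕ<n; toℕ-combine; combine-remQuot)
open import Data.Sum using (inj₁; inj₂; [_,_])
open import Data.Sum.Properties using ([,]-∘; [,]-cong)
open import Data.Product using (Σ; _×_; _,_; proj₁; proj₂)
open import Function using (_∘_; id)
open import Function.Bundles using (_⇔_; mk⇔)
open import Relation.Binary.PropositionalEquality
  using (_≡_; refl; sym; trans; cong; cong₂; subst; module ≡-Reasoning)
open ≡-Reasoning

prodF-cong : ∀ {k} (d d′ : Fin k → ℕ) → (∀ l → d l ≡ d′ l) → prodF d ≡ prodF d′
prodF-cong {zero}  d d′ d≡d′ = refl
prodF-cong {suc k} d d′ d≡d′ =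
  cong₂ _*_ (d≡d′ F.zero) (prodF-cong (d ∘ F.suc) (d′ ∘ F.suc) (d≡d′ ∘ F.suc))

ι-cong : ∀ {k} (d d′ : Fin k → ℕ) (t : Tuple d) (t′ : Tuple d′) →
  (∀ l → d l ≡ d′ l) → (∀ l → toℕ (t l) ≡ toℕ (t′ l)) → ι d t ≡ ι d′ t′
ι-cong {zero}  d d′ t t′ d≡d′ t≡t′ = refl
ι-cong {suc k} d d′ t t′ d≡d′ t≡t′ =
  cong₂ _+_ (cong₂ _*_ (t≡t′ F.zero) (prodF-cong (d ∘ F.suc) (d′ ∘ F.suc) (d≡d′ ∘ F.suc)))
            (ι-cong (d ∘ F.suc) (d′ ∘ F.suc) (t ∘ F.suc) (t′ ∘ F.suc) (d≡d′ ∘ F.suc) (t≡t′ ∘ F.suc))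

digit-bound : ∀ a b P x → a < b → x < P → a * P + x < b * P
digit-bound a b P x a<b x<P = ≤-trans (+-monoʳ-< (a * P) x<P)
  (≤-trans (≤-reflexive (+-comm (a * P) P)) (*-monoˡ-≤ P a<b))

ι-bound : ∀ {k} (d : Fin k → ℕ) (t : Tuple d) → ι d t < prodF d
ι-bound {zero}  d t = s≤s z≤n
ι-bound {suc k} d t =
  digit-bound (toℕ (t F.zero)) (d F.zero) _ _ (toℕ<n (t F.zero)) (ι-bound (d ∘ F.suc) (t ∘ F.suc))

leading-digit : ∀ d₀ P x → x < d₀ * P →
  Σ (Fin d₀) (λ a → Σ (Fin P) (λ b → toℕ a * P + toℕ b ≡ x))
leading-digit d₀ P x x< = a , b , (begin
  toℕ a * P + toℕ b        ≡⟨ cong (_+ toℕ b) (*-comm (toℕ a) P) ⟩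
  P * toℕ a + toℕ b        ≡⟨ sym (toℕ-combine a b) ⟩
  toℕ (combine a b)        ≡⟨ cong toℕ (combine-remQuot {d₀} P (fromℕ< x<)) ⟩
  toℕ (fromℕ< x<)          ≡⟨ toℕ-fromℕ< x< ⟩
  x                        ∎)
  where
  a = proj₁ (remQuot {d₀} P (fromℕ< x<))
  b = proj₂ (remQuot {d₀} P (fromℕ< x<))

ι-surjective : ∀ {k} (d : Fin k → ℕ) x → x < prodF d → Σ (Tuple d) (λ t → ι d t ≡ x)
ι-surjective {zero}  d zero    x<          = (λ ()) , refl
ι-surjective {zero}  d (suc x) (s≤s ())
ι-surjective {suc k} d x x< with leading-digit (d F.zero) (prodF (d ∘ F.suc)) x x<
... | a , b , a·P+b≡x with ι-surjective (d ∘ F.suc) (toℕ b) (toℕ<n b)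
... | t , ιt≡b = (λ { F.zero → a ; (F.suc l) → t l }) ,
                 trans (cong (toℕ a * prodF (d ∘ F.suc) +_) ιt≡b) a·P+b≡x

leftTuple : ∀ {r q} {d : Fin (r + q) → ℕ} → Tuple d → Tuple (firstPart r q d)
leftTuple {q = q} t l = t (l ↑ˡ q)

rightTuple : ∀ {r q} {d : Fin (r + q) → ℕ} → Tuple d → Tuple (secondPart r q d)
rightTuple {r} t l = t (r ↑ʳ l)

concatSeq-↑ˡ : ∀ {r q} {A : Set} (α : Fin r → A) (β : Fin q → A) l → concatSeq α β (l ↑ˡ q) ≡ α l
concatSeq-↑ˡ {r} {q} α β l = cong [ α , β ] (splitAt-↑ˡ r l q)

concatSeq-↑ʳ : ∀ {r q} {A : Set} (α : Fin r → A) (β : Fin q → A) l → concatSeq α β (r ↑ʳ l) ≡ β l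
concatSeq-↑ʳ {r} {q} α β l = cong [ α , β ] (splitAt-↑ʳ r q l)

concatSeq-all : ∀ {r q} {A : Set} (P : A → Set) (α : Fin r → A) (β : Fin q → A) →
  (∀ l → P (α l)) → (∀ l → P (β l)) → ∀ x → P (concatSeq α β x)
concatSeq-all {r} P α β Pα Pβ x with splitAt r x
... | inj₁ l = Pα l
... | inj₂ l = Pβ l

prodF-split : ∀ r q (d : Fin (r + q) → ℕ) → prodF d ≡ prodF (firstPart r q d) * prodF (secondPart r q d)
prodF-split zero    q d = sym (*-identityˡ _)
prodF-split (suc r) q d =
  trans (cong (d F.zero *_) (prodF-split r q (d ∘ F.suc))) (sym (*-assoc (d F.zero) _ _))

ι-split : ∀ r q (d : Fin (r + q) → ℕ) (t : Tuple d) →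
  ι d t ≡ ι (firstPart r q d) (leftTuple t) * prodF (secondPart r q d) + ι (secondPart r q d) (rightTuple t)
ι-split zero    q d t = refl
ι-split (suc r) q d t = begin
  a * prodF d′ + ι d′ (t ∘ F.suc)   ≡⟨ cong₂ (λ P Z → a * P + Z) (prodF-split r q d′) (ι-split r q d′ (t ∘ F.suc)) ⟩
  a * (B * C) + (X * C + Y)         ≡⟨ cong (_+ (X * C + Y)) (sym (*-assoc a B C)) ⟩
  a * B * C + (X * C + Y)           ≡⟨ sym (+-assoc (a * B * C) (X * C) Y) ⟩
  a * B * C + X * C + Y             ≡⟨ cong (_+ Y) (sym (*-distribʳ-+ C (a * B) X)) ⟩
  (a * B + X) * C + Y               ∎
  where
  d′ = d ∘ F.suc
  a  = toℕ (t F.zero)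
  B  = prodF (firstPart r q d′)
  C  = prodF (secondPart r q d′)
  X  = ι (firstPart r q d′) (leftTuple {r} {q} {d′} (t ∘ F.suc))
  Y  = ι (secondPart r q d′) (rightTuple {r} {q} {d′} (t ∘ F.suc))

join : ∀ r q (d : Fin (r + q) → ℕ) → Tuple (firstPart r q d) → Tuple (secondPart r q d) → Tuple d
join zero    q d u w         = w
join (suc r) q d u w F.zero    = u F.zero
join (suc r) q d u w (F.suc x) = join r q (d ∘ F.suc) (u ∘ F.suc) w x

join-↑ˡ : ∀ r q d u w (l : Fin r) → join r q d u w (l ↑ˡ q) ≡ u l
join-↑ˡ (suc r) q d u w F.zero    = refl
join-↑ˡ (suc r) q d u w (F.suc l) = join-↑ˡ r q (d ∘ F.suc) (u ∘ F.suc) w l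

join-↑ʳ : ∀ r q d u w (l : Fin q) → join r q d u w (r ↑ʳ l) ≡ w l
join-↑ʳ zero    q d u w l = refl
join-↑ʳ (suc r) q d u w l = join-↑ʳ r q (d ∘ F.suc) (u ∘ F.suc) w l

split-realise : ∀ r q (d : Fin (r + q) → ℕ) {i j} →
  i < prodF (firstPart r q d) → j < prodF (secondPart r q d) →
  Σ (Tuple d) (λ t → (ι d t ≡ i * prodF (secondPart r q d) + j)
                   × (ι (firstPart r q d) (leftTuple t) ≡ i)
                   × (ι (secondPart r q d) (rightTuple t) ≡ j))
split-realise r q d i< j< with ι-surjective (firstPart r q d) _ i< | ι-surjective (secondPart r q d) _ j<
... | u , refl | w , refl = t , trans (ι-split r q d t) (cong₂ (λ X Y → X * prodF (secondPart r q d) + Y) ιt₁ ιt₂) , ιt₁ , ιt₂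
  where
  t = join r q d u w
  ιt₁ : ι (firstPart r q d) (leftTuple t) ≡ ι (firstPart r q d) u
  ιt₁ = ι-cong _ _ _ _ (λ _ → refl) (λ l → cong toℕ (join-↑ˡ r q d u w l))
  ιt₂ : ι (secondPart r q d) (rightTuple t) ≡ ι (secondPart r q d) w
  ιt₂ = ι-cong _ _ _ _ (λ _ → refl) (λ l → cong toℕ (join-↑ʳ r q d u w l))

module _ {r q : ℕ} {A : Set} (f : Fin q → Fin r) (α : Fin r → A) (β : Fin q → A) where

  classValue : (∀ j → β j ≡ α (f j)) → ∀ i x → InClass f i x → concatSeq α β x ≡ α i
  classValue β≡αf i .(i ↑ˡ q) (inj₁ refl)            = concatSeq-↑ˡ α β i
  classValue β≡αf i .(r ↑ʳ j) (inj₂ (j , refl , fj≡i)) =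
    trans (concatSeq-↑ʳ α β j) (trans (β≡αf j) (cong α fj≡i))

  factors⇒respectsJ : (∀ j → β j ≡ α (f j)) → ∀ x y → J f x y → concatSeq α β x ≡ concatSeq α β y
  factors⇒respectsJ β≡αf x y (i , x∈i , y∈i) = trans (classValue β≡αf i x x∈i) (sym (classValue β≡αf i y y∈i))

  respectsJ⇒factors : (∀ x y → J f x y → concatSeq α β x ≡ concatSeq α β y) → ∀ j → β j ≡ α (f j)
  respectsJ⇒factors respects j = begin
    β j                         ≡⟨ sym (concatSeq-↑ʳ α β j) ⟩
    concatSeq α β (r ↑ʳ j)      ≡⟨ respects (r ↑ʳ j) (f j ↑ˡ q) (f j , inj₂ (j , refl , refl) , inj₁ refl) ⟩
    concatSeq α β (f j ↑ˡ q)    ≡⟨ concatSeq-↑ˡ α β (f j) ⟩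
    α (f j)                     ∎

Reindexes : ∀ {r q} {a : Fin r → ℕ} {b : Fin q → ℕ} → (Fin q → Fin r) → Tuple a → Tuple b → Set
Reindexes f u v = ∀ l → toℕ (v l) ≡ toℕ (u (f l))

Fab-J⇒ : ∀ {r q} (a : Fin r → ℕ) (b : Fin q → ℕ) (f : Fin q → Fin r) {i j} → Fab a b (J f) i j →
  Σ (Tuple a) (λ u → Σ (Tuple b) (λ v → (ι a u ≡ i) × (ι b v ≡ j) × Reindexes f u v))
Fab-J⇒ a b f (_ , _ , u , v , ιu≡i , ιv≡j , respects) =
  u , v , ιu≡i , ιv≡j , respectsJ⇒factors f (toℕ ∘ u) (toℕ ∘ v) respects

Fab-J⇐ : ∀ {r q} (a : Fin r → ℕ) (b : Fin q → ℕ) (f : Fin q → Fin r) {i j}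
  (u : Tuple a) (v : Tuple b) → ι a u ≡ i → ι b v ≡ j → Reindexes f u v → Fab a b (J f) i j
Fab-J⇐ a b f u v refl refl v≡u∘f =
  ι-bound a u , ι-bound b v , u , v , refl , refl , factors⇒respectsJ f (toℕ ∘ u) (toℕ ∘ v) v≡u∘f

codiag-concatSeq : ∀ {k} {A : Set} (α : Fin k → A) x → α (codiag k x) ≡ concatSeq α α x
codiag-concatSeq {k} α x = [,]-∘ α (splitAt k x)

duplicate : ∀ {k} (d : Fin k → ℕ) → Tuple d → Tuple (concatSeq d d)
duplicate {k} d u x = cast (codiag-concatSeq d x) (u (codiag k x))

duplicate-reindexes : ∀ {k} (d : Fin k → ℕ) (u : Tuple d) → Reindexes (codiag k) u (duplicate d u)
duplicate-reindexes {k} d u x = toℕ-cast (codiag-concatSeq d x) (u (codiag k x))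

ι-duplicate : ∀ {k} (d : Fin k → ℕ) (u : Tuple d) (v : Tuple (concatSeq d d)) →
  Reindexes (codiag k) u v → ι (concatSeq d d) v ≡ ι d u * prodF d + ι d u
ι-duplicate {k} d u v v≡u∘codiag = trans (ι-split k k (concatSeq d d) v)
  (cong₂ _+_ (cong₂ _*_ leftHalf (prodF-cong _ _ (concatSeq-↑ʳ d d))) rightHalf)
  where
  -- both halves of v are u, because codiag is the identity on each half
  leftHalf : ι (firstPart k k (concatSeq d d)) (leftTuple v) ≡ ι d u
  leftHalf = ι-cong _ _ _ _ (concatSeq-↑ˡ d d)
    (λ l → trans (v≡u∘codiag (l ↑ˡ k)) (cong (toℕ ∘ u) (concatSeq-↑ˡ id id l)))
  rightHalf : ι (secondPart k k (concatSeq d d)) (rightTuple v) ≡ ι d u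
  rightHalf = ι-cong _ _ _ _ (concatSeq-↑ʳ d d)
    (λ l → trans (v≡u∘codiag (k ↑ʳ l)) (cong (toℕ ∘ u) (concatSeq-↑ʳ id id l)))

module _ (n m : ℕ) (e : Fin (n + m) → ℕ) where
  private
    eN = firstPart n m e
    eM = secondPart n m e
    N  = prodF eN
    M  = prodF eM

    code-bound : (u : Tuple e) → ι e u < N * M
    code-bound u = subst (ι e u <_) (prodF-split n m e) (ι-bound e u)

  first-projection : ∀ x y → Fab e eN (J (incl₁ n m)) x y ⇔ GraphFst N M x y
  first-projection x y = mk⇔ to from
    where
    to : Fab e eN (J (incl₁ n m)) x y → GraphFst N M x y
    to fab with Fab-J⇒ e eN (incl₁ n m) fab
    ... | u , v , refl , refl , v≡u∘f =
      code-bound u , ι eN (leftTuple u) , ι eM (rightTuple u) , ι-bound eN _ , ι-bound eM _ ,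
      sym (ι-split n m e u) , ι-cong eN eN v (leftTuple u) (λ _ → refl) v≡u∘f
    from : GraphFst N M x y → Fab e eN (J (incl₁ n m)) x y
    from (_ , i , j , i< , j< , refl , refl) with split-realise n m e i< j<
    ... | t , ιt , ιt₁ , _ = Fab-J⇐ e eN (incl₁ n m) t (leftTuple t) ιt ιt₁ (λ _ → refl)

  second-projection : ∀ x y → Fab e eM (J (incl₂ n m)) x y ⇔ GraphSnd N M x y
  second-projection x y = mk⇔ to from
    where
    to : Fab e eM (J (incl₂ n m)) x y → GraphSnd N M x y
    to fab with Fab-J⇒ e eM (incl₂ n m) fab
    ... | u , v , refl , refl , v≡u∘g =
      code-bound u , ι eN (leftTuple u) , ι eM (rightTuple u) , ι-bound eN _ , ι-bound eM _ ,
      sym (ι-split n m e u) , ι-cong eM eM v (rightTuple u) (λ _ → refl) v≡u∘g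
    from : GraphSnd N M x y → Fab e eM (J (incl₂ n m)) x y
    from (_ , i , j , i< , j< , refl , refl) with split-realise n m e i< j<
    ... | t , ιt , _ , ιt₂ = Fab-J⇐ e eM (incl₂ n m) t (rightTuple t) ιt ιt₂ (λ _ → refl)

diagonal : ∀ {n} (d : Fin n → ℕ) x y →
  Fab d (concatSeq d d) (J (codiag n)) x y ⇔ GraphDiag (prodF d) x y
diagonal {n} d x y = mk⇔ to from
  where
  to : Fab d (concatSeq d d) (J (codiag n)) x y → GraphDiag (prodF d) x y
  to fab with Fab-J⇒ d (concatSeq d d) (codiag n) fab
  ... | u , v , refl , refl , v≡u∘w = ι-bound d u , ι-duplicate d u v v≡u∘w
  from : GraphDiag (prodF d) x y → Fab d (concatSeq d d) (J (codiag n)) x y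
  from (x< , refl) with ι-surjective d x x<
  ... | u , refl = Fab-J⇐ d (concatSeq d d) (codiag n) u (duplicate d u) refl
                     (ι-duplicate d u (duplicate d u) (duplicate-reindexes d u)) (duplicate-reindexes d u)

-- A sequence appropriate for J(w^op) is a b with b = a a; padding a by 2's to
-- length n + m exhibits it in the form of the statement.
codiag-appropriate : ∀ n m (a : Fin n → ℕ) (b : Fin (n + n) → ℕ) → AllGe2 a →
  Appropriate a b (J (codiag n)) →
  Σ (Fin (n + m) → ℕ) (λ e′ → AllGe2 e′ ×
    (∀ x → a x ≡ firstPart n m e′ x) ×
    (∀ x → b x ≡ concatSeq (firstPart n m e′) (firstPart n m e′) x))
codiag-appropriate n m a b a≥2 appropriate =
  e′ , concatSeq-all (2 ≤_) a (λ _ → 2) a≥2 (λ _ → ≤-reflexive refl) , a≡e′ , λ x → begin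
    b x                                               ≡⟨ respectsJ⇒factors (codiag n) a b appropriate x ⟩
    a (codiag n x)                                    ≡⟨ codiag-concatSeq a x ⟩
    concatSeq a a x                                   ≡⟨ [,]-cong a≡e′ a≡e′ (splitAt n x) ⟩
    concatSeq (firstPart n m e′) (firstPart n m e′) x ∎
  where
  e′ : Fin (n + m) → ℕ
  e′ = concatSeq a (λ _ → 2)
  a≡e′ : ∀ x → a x ≡ firstPart n m e′ x
  a≡e′ x = sym (concatSeq-↑ˡ a (λ _ → 2) x)

lemma3 : (n m : ℕ) (e : Fin (n + m) → ℕ) → AllGe2 e →
  let eN = firstPart n m e
      eM = secondPart n m e
      N = prodF eN
      M = prodF eM
  in
  -- (i)
  ((∀ x y → Fab e eN (J (incl₁ n m)) x y ⇔ GraphFst N M x y)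
    × Appropriate e eN (J (incl₁ n m))
    × (∀ (a : Fin (n + m) → ℕ) (b : Fin n → ℕ) → AllGe2 a → AllGe2 b →
         Appropriate a b (J (incl₁ n m)) →
         Σ (Fin (n + m) → ℕ) (λ e′ → AllGe2 e′ ×
           (∀ x → a x ≡ e′ x) × (∀ x → b x ≡ firstPart n m e′ x))))
  -- (ii)
  × ((∀ x y → Fab e eM (J (incl₂ n m)) x y ⇔ GraphSnd N M x y)
    × Appropriate e eM (J (incl₂ n m))
    × (∀ (a : Fin (n + m) → ℕ) (b : Fin m → ℕ) → AllGe2 a → AllGe2 b →
         Appropriate a b (J (incl₂ n m)) →
         Σ (Fin (n + m) → ℕ) (λ e′ → AllGe2 e′ ×
           (∀ x → a x ≡ e′ x) × (∀ x → b x ≡ secondPart n m e′ x))))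
  -- (iii)
  × ((∀ x y → Fab eN (concatSeq eN eN) (J (codiag n)) x y ⇔ GraphDiag N x y)
    × Appropriate eN (concatSeq eN eN) (J (codiag n))
    × (∀ (a : Fin n → ℕ) (b : Fin (n + n) → ℕ) → AllGe2 a → AllGe2 b →
         Appropriate a b (J (codiag n)) →
         Σ (Fin (n + m) → ℕ) (λ e′ → AllGe2 e′ ×
           (∀ x → a x ≡ firstPart n m e′ x) ×
           (∀ x → b x ≡ concatSeq (firstPart n m e′) (firstPart n m e′) x))))
lemma3 n m e _ =
    ( first-projection n m e
    , factors⇒respectsJ (incl₁ n m) e (firstPart n m e) (λ _ → refl)
    , λ a b a≥2 _ appropriate → a , a≥2 , (λ _ → refl) , respectsJ⇒factors (incl₁ n m) a b appropriate)
  , ( second-projection n m e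
    , factors⇒respectsJ (incl₂ n m) e (secondPart n m e) (λ _ → refl)
    , λ a b a≥2 _ appropriate → a , a≥2 , (λ _ → refl) , respectsJ⇒factors (incl₂ n m) a b appropriate)
  , ( diagonal (firstPart n m e)
    , factors⇒respectsJ (codiag n) eN (concatSeq eN eN) (λ x → sym (codiag-concatSeq eN x))
    , λ a b a≥2 _ → codiag-appropriate n m a b a≥2)
  where
  eN = firstPart n m e
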